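{- Let $\mathbf A$ be a connexive Heyting algebra. For all $a,b\in A$: $a\rightarrow b=1$ if and only if $a\le b$ and $\neg a=\neg b$.
   Context: A connexive Heyting algebra is an algebra $\langle A,\wedge,\vee,\rightarrow,0,1\rangle$ whose $\{\wedge,\vee,0,1\}$-reduct is a bounded distributive lattice with lattice order $\le$, satisfying, with $\neg x:=x\rightarrow0$: (C1) $(x\rightarrow y)\rightarrow((y\rightarrow z)\rightarrow(x\rightarrow z))=1$; (C2) $(x\rightarrow y)\rightarrow\neg(x\rightarrow\neg y)=1$; (C3) $x\wedge(x\rightarrow y)=x\wedge y$; (C4) $x\rightarrow y\le(z\wedge x)\rightarrow(z\wedge y)$; (C5) $x\rightarrow y\le(z\vee x)\rightarrow(z\vee y)$. -}

module Defs where

open import Level using (Level; suc; _⊔_)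
open import Relation.Binary.Core using (Rel)
open import Algebra.Core using (Op₂)
open import Algebra.Definitions using (Congruent₂)
open import Algebra.Lattice.Structures using (IsDistributiveLattice)

record ConnexiveHeytingAlgebra c ℓ : Set (suc (c ⊔ ℓ)) where
  infixr 5 _⇒_
  infixr 7 _∧_
  infixr 6 _∨_
  infix  4 _≈_ _≤_
  field
    Carrier : Set c
    _≈_     : Rel Carrier ℓ
    _∧_     : Op₂ Carrier
    _∨_     : Op₂ Carrier
    _⇒_     : Op₂ Carrier
    𝟘       : Carrier
    𝟙       : Carrier
    isDistributiveLattice : IsDistributiveLattice _≈_ _∨_ _∧_
    ⇒-cong  : Congruent₂ _≈_ _⇒_

  _≤_ : Rel Carrier ℓ
  x ≤ y = (x ∧ y) ≈ x

  ¬_ : Carrier → Carrier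
  ¬ x = x ⇒ 𝟘

  field
    𝟘-least    : ∀ x → 𝟘 ≤ x
    𝟙-greatest : ∀ x → x ≤ 𝟙
    C1 : ∀ x y z → ((x ⇒ y) ⇒ ((y ⇒ z) ⇒ (x ⇒ z))) ≈ 𝟙
    C2 : ∀ x y → ((x ⇒ y) ⇒ (¬ (x ⇒ (¬ y)))) ≈ 𝟙
    C3 : ∀ x y → (x ∧ (x ⇒ y)) ≈ (x ∧ y)
    C4 : ∀ x y z → (x ⇒ y) ≤ ((z ∧ x) ⇒ (z ∧ y))
    C5 : ∀ x y z → (x ⇒ y) ≤ ((z ∨ x) ⇒ (z ∨ y))

  open IsDistributiveLattice isDistributiveLattice public

{-# OPTIONS --safe #-}

-- Every valid implication a ⇒ b satisfies a ≤ b by (C3), and by suffixing (C1)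
-- also ¬ b ≤ ¬ a.  The reverse inequality comes from connexivity: (C2) makes
-- a ⇒ ¬ a equal to 𝟘, so suffixing with ¬ a forces b ⇒ ¬ a = 𝟘, hence b ∧ ¬ a = 𝟘
-- and ¬ a ≤ ¬ b.  Conversely, (C4) meets the valid implication a ⇒ ¬ ¬ a with b;
-- when a ≤ b and ¬ a = ¬ b this turns it into a ⇒ b, because b ≤ ¬ ¬ b.
module Submission where

open import Defs
open import Data.Product using (_×_; _,_)
open import Function.Bundles using (_⇔_; mk⇔)
open import Relation.Binary.Bundles using (Setoid)
import Relation.Binary.Reasoning.Setoid as SetoidReasoning

module ConnexiveHeytingAlgebraProperties
  {c ℓ} (A : ConnexiveHeytingAlgebra c ℓ) where

  open ConnexiveHeytingAlgebra A

  setoid : Setoid c ℓ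
  setoid = record { isEquivalence = isEquivalence }

  open SetoidReasoning setoid

  Valid : Carrier → Set ℓ
  Valid x = x ≈ 𝟙

  ≤-antisym : ∀ {x y} → x ≤ y → y ≤ x → x ≈ y
  ≤-antisym {x} {y} x≤y y≤x = begin
    x      ≈⟨ x≤y ⟨
    x ∧ y  ≈⟨ ∧-comm x y ⟩
    y ∧ x  ≈⟨ y≤x ⟩
    y      ∎

  ∧-identityʳ : ∀ x → x ∧ 𝟙 ≈ x
  ∧-identityʳ = 𝟙-greatest

  ∧-identityˡ : ∀ x → 𝟙 ∧ x ≈ x
  ∧-identityˡ x = trans (∧-comm 𝟙 x) (∧-identityʳ x)

  ∧-zeroʳ : ∀ x → x ∧ 𝟘 ≈ 𝟘
  ∧-zeroʳ x = trans (∧-comm x 𝟘) (𝟘-least x)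

  𝟙≤⇒≈𝟙 : ∀ {x} → 𝟙 ≤ x → x ≈ 𝟙
  𝟙≤⇒≈𝟙 {x} 𝟙≤x = trans (sym (∧-identityˡ x)) 𝟙≤x

  ⇒-identityˡ : ∀ x → 𝟙 ⇒ x ≈ x
  ⇒-identityˡ x = begin
    𝟙 ⇒ x        ≈⟨ ∧-identityˡ (𝟙 ⇒ x) ⟨
    𝟙 ∧ (𝟙 ⇒ x)  ≈⟨ C3 𝟙 x ⟩
    𝟙 ∧ x        ≈⟨ ∧-identityˡ x ⟩
    x            ∎

  modus-ponens : ∀ {x y} → Valid x → Valid (x ⇒ y) → Valid y
  modus-ponens {x} {y} ⊨x ⊨x⇒y = begin
    y      ≈⟨ ⇒-identityˡ y ⟨
    𝟙 ⇒ y  ≈⟨ ⇒-cong ⊨x refl ⟨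
    x ⇒ y  ≈⟨ ⊨x⇒y ⟩
    𝟙      ∎

  valid⇒≤ : ∀ {x y} → Valid (x ⇒ y) → x ≤ y
  valid⇒≤ {x} {y} ⊨x⇒y = begin
    x ∧ y        ≈⟨ C3 x y ⟨
    x ∧ (x ⇒ y)  ≈⟨ ∧-congˡ ⊨x⇒y ⟩
    x ∧ 𝟙        ≈⟨ ∧-identityʳ x ⟩
    x            ∎

  ¬-valid⇒≈𝟘 : ∀ {x} → Valid (¬ x) → x ≈ 𝟘
  ¬-valid⇒≈𝟘 {x} ⊨¬x = begin
    x            ≈⟨ ∧-identityʳ x ⟨
    x ∧ 𝟙        ≈⟨ ∧-congˡ ⊨¬x ⟨
    x ∧ (x ⇒ 𝟘)  ≈⟨ C3 x 𝟘 ⟩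
    x ∧ 𝟘        ≈⟨ ∧-zeroʳ x ⟩
    𝟘            ∎

  ⇒≈𝟘⇒∧≈𝟘 : ∀ {x y} → x ⇒ y ≈ 𝟘 → x ∧ y ≈ 𝟘
  ⇒≈𝟘⇒∧≈𝟘 {x} {y} x⇒y≈𝟘 = begin
    x ∧ y        ≈⟨ C3 x y ⟨
    x ∧ (x ⇒ y)  ≈⟨ ∧-congˡ x⇒y≈𝟘 ⟩
    x ∧ 𝟘        ≈⟨ ∧-zeroʳ x ⟩
    𝟘            ∎

  ∧-complementʳ : ∀ x → x ∧ ¬ x ≈ 𝟘
  ∧-complementʳ x = trans (C3 x 𝟘) (∧-zeroʳ x)

  ∧≈𝟘⇒≤¬ : ∀ {x y} → y ∧ x ≈ 𝟘 → y ≤ ¬ x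
  ∧≈𝟘⇒≤¬ {x} {y} y∧x≈𝟘 = begin
    y ∧ (x ⇒ 𝟘)                ≈⟨ ∧-cong (⇒-identityˡ y) (⇒-cong (∧-identityʳ x) x∧y≈𝟘) ⟨
    (𝟙 ⇒ y) ∧ (x ∧ 𝟙 ⇒ x ∧ y)  ≈⟨ C4 𝟙 y x ⟩
    𝟙 ⇒ y                      ≈⟨ ⇒-identityˡ y ⟩
    y                          ∎
    where x∧y≈𝟘 = trans (∧-comm x y) y∧x≈𝟘

  ≤¬¬ : ∀ x → x ≤ ¬ ¬ x
  ≤¬¬ x = ∧≈𝟘⇒≤¬ (∧-complementʳ x)

  suffixing : ∀ {x y} z → Valid (x ⇒ y) → Valid ((y ⇒ z) ⇒ (x ⇒ z))
  suffixing {x} {y} z ⊨x⇒y = modus-ponens ⊨x⇒y (C1 x y z)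

  ⇒-refl : ∀ x → Valid (x ⇒ x)
  ⇒-refl x = begin
    x ⇒ x                ≈⟨ ⇒-cong (⇒-identityˡ x) (⇒-identityˡ x) ⟨
    (𝟙 ⇒ x) ⇒ (𝟙 ⇒ x)  ≈⟨ suffixing x (⇒-identityˡ 𝟙) ⟩
    𝟙                    ∎

  valid⇒⇒¬≈𝟘 : ∀ {x y} → Valid (x ⇒ y) → x ⇒ ¬ y ≈ 𝟘
  valid⇒⇒¬≈𝟘 {x} {y} ⊨x⇒y = ¬-valid⇒≈𝟘 (modus-ponens ⊨x⇒y (C2 x y))

  ⇒¬-self : ∀ x → x ⇒ ¬ x ≈ 𝟘
  ⇒¬-self x = valid⇒⇒¬≈𝟘 (⇒-refl x)

  ⇒¬¬-valid : ∀ x → Valid (x ⇒ ¬ ¬ x)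
  ⇒¬¬-valid x = begin
    x ⇒ ¬ ¬ x                  ≈⟨ ⇒-cong (⇒-identityˡ x) (⇒-cong (⇒-identityˡ (¬ x)) refl) ⟨
    (𝟙 ⇒ x) ⇒ ¬ (𝟙 ⇒ ¬ x)    ≈⟨ C2 𝟙 x ⟩
    𝟙                          ∎

  valid⇒¬-antitone : ∀ {x y} → Valid (x ⇒ y) → ¬ y ≤ ¬ x
  valid⇒¬-antitone ⊨x⇒y = valid⇒≤ (suffixing 𝟘 ⊨x⇒y)

  valid⇒¬-monotone : ∀ {x y} → Valid (x ⇒ y) → ¬ x ≤ ¬ y
  valid⇒¬-monotone {x} {y} ⊨x⇒y =
    ∧≈𝟘⇒≤¬ (trans (∧-comm (¬ x) y) (⇒≈𝟘⇒∧≈𝟘 y⇒¬x≈𝟘))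
    where
    ⊨¬[y⇒¬x] : Valid (¬ (y ⇒ ¬ x))
    ⊨¬[y⇒¬x] = trans (⇒-cong refl (sym (⇒¬-self x))) (suffixing (¬ x) ⊨x⇒y)
    y⇒¬x≈𝟘 : y ⇒ ¬ x ≈ 𝟘
    y⇒¬x≈𝟘 = ¬-valid⇒≈𝟘 ⊨¬[y⇒¬x]

  valid⇒≤×¬≈ : ∀ {x y} → Valid (x ⇒ y) → x ≤ y × ¬ x ≈ ¬ y
  valid⇒≤×¬≈ ⊨x⇒y =
    valid⇒≤ ⊨x⇒y , ≤-antisym (valid⇒¬-monotone ⊨x⇒y) (valid⇒¬-antitone ⊨x⇒y)

  ≤×¬≈⇒valid : ∀ {x y} → x ≤ y × ¬ x ≈ ¬ y → Valid (x ⇒ y)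
  ≤×¬≈⇒valid {x} {y} (x≤y , ¬x≈¬y) = 𝟙≤⇒≈𝟙 (begin
    𝟙 ∧ (x ⇒ y)                          ≈⟨ ∧-cong (⇒¬¬-valid x) (⇒-cong y∧x≈x y∧¬¬x≈y) ⟨
    (x ⇒ ¬ ¬ x) ∧ (y ∧ x ⇒ y ∧ ¬ ¬ x)  ≈⟨ C4 x (¬ ¬ x) y ⟩
    x ⇒ ¬ ¬ x                            ≈⟨ ⇒¬¬-valid x ⟩
    𝟙                                    ∎)
    where
    y∧x≈x : y ∧ x ≈ x
    y∧x≈x = trans (∧-comm y x) x≤y
    y∧¬¬x≈y : y ∧ ¬ ¬ x ≈ y
    y∧¬¬x≈y = trans (∧-congˡ (⇒-cong ¬x≈¬y refl)) (≤¬¬ y)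

theorem3p7 : ∀ {c ℓ} (A : ConnexiveHeytingAlgebra c ℓ) →
    let open ConnexiveHeytingAlgebra A in
    ∀ (a b : Carrier) → ((a ⇒ b) ≈ 𝟙) ⇔ ((a ≤ b) × ((¬ a) ≈ (¬ b)))
theorem3p7 A a b = mk⇔ valid⇒≤×¬≈ ≤×¬≈⇒valid
  where open ConnexiveHeytingAlgebraProperties A
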